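{- For every $w\in\{\mathtt{0},\mathtt{1}\}^*$, $\mu_q(w\mathtt{0})_{12}\prec\mu_q(w\mathtt{1})_{12}$ and $\mu_q(\mathtt{1}w)_{12}\prec\mu_q(\mathtt{0}w\mathtt{0})_{12}\prec\mu_q(\mathtt{0}w\mathtt{1})_{12}$.
   Context: $\mu_q$ is the monoid homomorphism $\{\mathtt{0},\mathtt{1}\}^*\to\mathrm{GL}_2(\mathbb{Z}[q^{\pm1}])$ with $\mu_q(\mathtt{0})=\begin{pmatrix} q+q^2 & 1\\ q & 1\end{pmatrix}$, $\mu_q(\mathtt{1})=\begin{pmatrix} q+2q^2+q^3+q^4 & 1+q\\ q+q^2 & 1\end{pmatrix}$; $M_{12}$ is the (row 1, column 2) entry of $M$. For $f,g\in\mathbb{Z}[q]$, $f\prec g$ means $f\ne g$ and $g-f$ has nonnegative integer coefficients. -}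

module Defs where

open import Data.Nat using (ℕ; zero; suc)
open import Data.Integer using (ℤ; +_; _+_; _*_; -_; _≤_; 0ℤ)
open import Data.List using (List; []; _∷_; foldr)
open import Relation.Binary.PropositionalEquality using (_≡_)
open import Relation.Nullary using (¬_)
open import Data.Product using (_×_)

-- Polynomials in ℤ[q] as coefficient lists, lowest degree first:
-- a₀ ∷ a₁ ∷ … represents a₀ + a₁ q + a₂ q² + …  (trailing zeros allowed).
Poly : Set
Poly = List ℤ

coeff : Poly → ℕ → ℤ
coeff []       _       = 0ℤ
coeff (a ∷ _)  zero    = a
coeff (_ ∷ p)  (suc n) = coeff p n

infixl 6 _⊕_
infixl 7 _⊗_ _·_

_⊕_ : Poly → Poly → Poly
[]      ⊕ g       = g
(a ∷ f) ⊕ []      = a ∷ f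
(a ∷ f) ⊕ (b ∷ g) = (a + b) ∷ (f ⊕ g)

_·_ : ℤ → Poly → Poly
c · []      = []
c · (a ∷ f) = (c * a) ∷ (c · f)

_⊗_ : Poly → Poly → Poly
[]      ⊗ g = []
(a ∷ f) ⊗ g = (a · g) ⊕ (0ℤ ∷ (f ⊗ g))

_≈ₚ_ : Poly → Poly → Set
f ≈ₚ g = ∀ n → coeff f n ≡ coeff g n

_≺_ : Poly → Poly → Set
f ≺ g = ¬ (f ≈ₚ g) × (∀ n → coeff f n ≤ coeff g n)

record Mat : Set where
  constructor mat
  field
    m11 m12 m21 m22 : Poly
open Mat public

_⊠_ : Mat → Mat → Mat
mat a b c d ⊠ mat e f g h =
  mat (a ⊗ e ⊕ b ⊗ g) (a ⊗ f ⊕ b ⊗ h) (c ⊗ e ⊕ d ⊗ g) (c ⊗ f ⊕ d ⊗ h)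

I₂ : Mat
I₂ = mat (+ 1 ∷ []) [] [] (+ 1 ∷ [])

data Letter : Set where
  𝟎 𝟏 : Letter

Word : Set
Word = List Letter

-- μ_q(0) = [[q+q², 1], [q, 1]]
-- μ_q(1) = [[q+2q²+q³+q⁴, 1+q], [q+q², 1]]
μLetter : Letter → Mat
μLetter 𝟎 = mat (+ 0 ∷ + 1 ∷ + 1 ∷ []) (+ 1 ∷ []) (+ 0 ∷ + 1 ∷ []) (+ 1 ∷ [])
μLetter 𝟏 = mat (+ 0 ∷ + 1 ∷ + 2 ∷ + 1 ∷ + 1 ∷ []) (+ 1 ∷ + 1 ∷ [])
                (+ 0 ∷ + 1 ∷ + 1 ∷ []) (+ 1 ∷ [])

μ : Word → Mat
μ = foldr (λ a M → μLetter a ⊠ M) I₂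

-- Write μ(w) = [[a, b], [c, d]].  For every word the entries are nonnegative and
-- a − q·b is nonnegative and nonzero; this invariant survives right
-- multiplication by either generator.  Appending 1 instead of 0 adds q·a to the
-- (1,2) entry, which gives the two outer inequalities.  For the middle one,
-- write w = w′y: the difference between μ(0w0)₁₂ and μ(1w)₁₂ is then a polynomial
-- in q and the entries of μ(w′) with nonnegative coefficients, and it is nonzero
-- because a − q·b is.
module Submission where

open import Defs
open import Algebra.Bundles using (AbelianGroup; CommutativeMonoid; CommutativeSemiring)
open import Data.Integer using (nonNegative; 0ℤ; 1ℤ; _+_; _*_; _≤_; +≤+)
import Data.Integer.Properties as ℤP
open import Data.List using ([]; _∷_; _++_; _∷ʳ_; initLast; _∷ʳ′_)
open import Data.List.Reverse using (Reverse; []; _∶_∶ʳ_; reverseView)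
open import Data.Maybe using (nothing)
open import Data.Nat using (zero; suc; z≤n)
open import Data.Product using (_×_; _,_; proj₁; proj₂; uncurry)
open import Function using (_∘_)
open import Relation.Binary.Bundles using (Setoid)
open import Relation.Binary.Definitions using (Decidable)
open import Relation.Binary.PropositionalEquality
  using (_≡_; refl; sym; trans; cong; cong₂; module ≡-Reasoning)
open import Relation.Binary.Structures using (IsEquivalence)
import Relation.Binary.Reasoning.Setoid
open import Relation.Nullary using (¬_)
open import Relation.Nullary.Decidable using (yes; map′; _×-dec_; from-yes)
open import Tactic.RingSolver using (solve-∀)
open import Tactic.RingSolver.Core.AlmostCommutativeRing
  using (AlmostCommutativeRing; fromCommutativeSemiring)

open import Algebra.Properties.Group (AbelianGroup.group ℤP.+-0-abelianGroup)
  using (identityʳ-unique)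

infix 4 _≋_ _≋?_

-- _≈ₚ_ as a record, so that both polynomials can be inferred from a proof.
record _≋_ (f g : Poly) : Set where
  constructor mk≋
  field coeff-≡ : f ≈ₚ g
open _≋_ public

≋-refl : ∀ {f} → f ≋ f
≋-refl = mk≋ λ _ → refl

≋-sym : ∀ {f g} → f ≋ g → g ≋ f
≋-sym (mk≋ e) = mk≋ (sym ∘ e)

≋-trans : ∀ {f g h} → f ≋ g → g ≋ h → f ≋ h
≋-trans (mk≋ e) (mk≋ e′) = mk≋ λ n → trans (e n) (e′ n)

≋-isEquivalence : IsEquivalence _≋_
≋-isEquivalence = record { refl = ≋-refl ; sym = ≋-sym ; trans = ≋-trans }

≋-setoid : Setoid _ _
≋-setoid = record { isEquivalence = ≋-isEquivalence }

∷-cong : ∀ {a b f g} → a ≡ b → f ≋ g → a ∷ f ≋ b ∷ g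
∷-cong a≡b (mk≋ e) = mk≋ λ { zero → a≡b ; (suc n) → e n }

∷-injective : ∀ {a b f g} → a ∷ f ≋ b ∷ g → a ≡ b × f ≋ g
∷-injective (mk≋ e) = e zero , mk≋ (e ∘ suc)

[]≋0∷[] : [] ≋ 0ℤ ∷ []
[]≋0∷[] = mk≋ λ { zero → refl ; (suc _) → refl }

_≋?_ : Decidable _≋_
[]      ≋? []      = yes ≋-refl
[]      ≋? (b ∷ g) = map′ (≋-trans []≋0∷[] ∘ uncurry ∷-cong)
                          (∷-injective ∘ ≋-trans (≋-sym []≋0∷[]))
                          (0ℤ ℤP.≟ b ×-dec [] ≋? g)
(a ∷ f) ≋? []      = map′ (λ e → ≋-trans (uncurry ∷-cong e) (≋-sym []≋0∷[]))
                          (λ e → ∷-injective (≋-trans e []≋0∷[]))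
                          (a ℤP.≟ 0ℤ ×-dec f ≋? [])
(a ∷ f) ≋? (b ∷ g) = map′ (uncurry ∷-cong) ∷-injective (a ℤP.≟ b ×-dec f ≋? g)

coeff-⊕ : ∀ f g n → coeff (f ⊕ g) n ≡ coeff f n + coeff g n
coeff-⊕ []      g       n       = sym (ℤP.+-identityˡ _)
coeff-⊕ (a ∷ f) []      n       = sym (ℤP.+-identityʳ _)
coeff-⊕ (a ∷ f) (b ∷ g) zero    = refl
coeff-⊕ (a ∷ f) (b ∷ g) (suc n) = coeff-⊕ f g n

coeff-· : ∀ c f n → coeff (c · f) n ≡ c * coeff f n
coeff-· c []      n       = sym (ℤP.*-zeroʳ c)
coeff-· c (a ∷ f) zero    = refl
coeff-· c (a ∷ f) (suc n) = coeff-· c f n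

⊕-cong : ∀ {f f′ g g′} → f ≋ f′ → g ≋ g′ → f ⊕ g ≋ f′ ⊕ g′
⊕-cong {f} {f′} {g} {g′} (mk≋ e) (mk≋ e′) = mk≋ λ n → begin
  coeff (f ⊕ g) n          ≡⟨ coeff-⊕ f g n ⟩
  coeff f n + coeff g n    ≡⟨ cong₂ _+_ (e n) (e′ n) ⟩
  coeff f′ n + coeff g′ n  ≡⟨ coeff-⊕ f′ g′ n ⟨
  coeff (f′ ⊕ g′) n        ∎
  where open ≡-Reasoning

⊕-assoc : ∀ f g h → (f ⊕ g) ⊕ h ≋ f ⊕ (g ⊕ h)
⊕-assoc f g h = mk≋ λ n → begin
  coeff ((f ⊕ g) ⊕ h) n              ≡⟨ coeff-⊕ (f ⊕ g) h n ⟩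
  coeff (f ⊕ g) n + coeff h n        ≡⟨ cong (_+ coeff h n) (coeff-⊕ f g n) ⟩
  coeff f n + coeff g n + coeff h n  ≡⟨ ℤP.+-assoc (coeff f n) _ _ ⟩
  coeff f n + (coeff g n + coeff h n) ≡⟨ cong (coeff f n +_) (coeff-⊕ g h n) ⟨
  coeff f n + coeff (g ⊕ h) n        ≡⟨ coeff-⊕ f (g ⊕ h) n ⟨
  coeff (f ⊕ (g ⊕ h)) n              ∎
  where open ≡-Reasoning

⊕-comm : ∀ f g → f ⊕ g ≋ g ⊕ f
⊕-comm f g = mk≋ λ n →
  trans (coeff-⊕ f g n) (trans (ℤP.+-comm (coeff f n) _) (sym (coeff-⊕ g f n)))

⊕-identityˡ : ∀ f → [] ⊕ f ≋ f
⊕-identityˡ _ = ≋-refl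

⊕-identityʳ : ∀ f → f ⊕ [] ≋ f
⊕-identityʳ []      = ≋-refl
⊕-identityʳ (_ ∷ _) = ≋-refl

·-congʳ : ∀ {c f g} → f ≋ g → c · f ≋ c · g
·-congʳ {c} {f} {g} (mk≋ e) = mk≋ λ n →
  trans (coeff-· c f n) (trans (cong (c *_) (e n)) (sym (coeff-· c g n)))

·-distribˡ-⊕ : ∀ c f g → c · (f ⊕ g) ≋ c · f ⊕ c · g
·-distribˡ-⊕ c f g = mk≋ λ n → begin
  coeff (c · (f ⊕ g)) n                    ≡⟨ coeff-· c (f ⊕ g) n ⟩
  c * coeff (f ⊕ g) n                      ≡⟨ cong (c *_) (coeff-⊕ f g n) ⟩
  c * (coeff f n + coeff g n)              ≡⟨ ℤP.*-distribˡ-+ c (coeff f n) _ ⟩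
  c * coeff f n + c * coeff g n            ≡⟨ cong₂ _+_ (coeff-· c f n) (coeff-· c g n) ⟨
  coeff (c · f) n + coeff (c · g) n        ≡⟨ coeff-⊕ (c · f) (c · g) n ⟨
  coeff (c · f ⊕ c · g) n                  ∎
  where open ≡-Reasoning

·-distribʳ-+ : ∀ a b f → (a + b) · f ≋ a · f ⊕ b · f
·-distribʳ-+ a b f = mk≋ λ n → begin
  coeff ((a + b) · f) n                    ≡⟨ coeff-· (a + b) f n ⟩
  (a + b) * coeff f n                      ≡⟨ ℤP.*-distribʳ-+ (coeff f n) a b ⟩
  a * coeff f n + b * coeff f n            ≡⟨ cong₂ _+_ (coeff-· a f n) (coeff-· b f n) ⟨
  coeff (a · f) n + coeff (b · f) n        ≡⟨ coeff-⊕ (a · f) (b · f) n ⟨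
  coeff (a · f ⊕ b · f) n                  ∎
  where open ≡-Reasoning

·-assoc : ∀ c d f → (c * d) · f ≋ c · (d · f)
·-assoc c d f = mk≋ λ n → begin
  coeff ((c * d) · f) n    ≡⟨ coeff-· (c * d) f n ⟩
  c * d * coeff f n        ≡⟨ ℤP.*-assoc c d _ ⟩
  c * (d * coeff f n)      ≡⟨ cong (c *_) (coeff-· d f n) ⟨
  c * coeff (d · f) n      ≡⟨ coeff-· c (d · f) n ⟨
  coeff (c · (d · f)) n    ∎
  where open ≡-Reasoning

·-zeroˡ : ∀ f → 0ℤ · f ≋ []
·-zeroˡ f = mk≋ (coeff-· 0ℤ f)

·-identityˡ : ∀ f → 1ℤ · f ≋ f
·-identityˡ f = mk≋ λ n → trans (coeff-· 1ℤ f n) (ℤP.*-identityˡ (coeff f n))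

open import Algebra.Structures _≋_ using (IsCommutativeMonoid)
open import Algebra.Structures.Biased _≋_ using (isCommutativeMonoidˡ; isCommutativeSemiringˡ)

⊕-isCommutativeMonoid : IsCommutativeMonoid _⊕_ []
⊕-isCommutativeMonoid = isCommutativeMonoidˡ record
  { isSemigroup = record
    { isMagma = record { isEquivalence = ≋-isEquivalence ; ∙-cong = ⊕-cong }
    ; assoc   = ⊕-assoc
    }
  ; identityˡ = ⊕-identityˡ
  ; comm      = ⊕-comm
  }

⊕-commutativeMonoid : CommutativeMonoid _ _
⊕-commutativeMonoid = record { isCommutativeMonoid = ⊕-isCommutativeMonoid }

open import Algebra.Properties.CommutativeSemigroup
  (CommutativeMonoid.commutativeSemigroup ⊕-commutativeMonoid)
  using (interchange; x∙yz≈y∙xz)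
module ≋-Reasoning = Relation.Binary.Reasoning.Setoid ≋-setoid

⊗-congʳ : ∀ f {g g′} → g ≋ g′ → f ⊗ g ≋ f ⊗ g′
⊗-congʳ []      _    = ≋-refl
⊗-congʳ (a ∷ f) g≋g′ = ⊕-cong (·-congʳ g≋g′) (∷-cong refl (⊗-congʳ f g≋g′))

·-⊗-assoc : ∀ c f g → (c · f) ⊗ g ≋ c · (f ⊗ g)
·-⊗-assoc c []      g = ≋-refl
·-⊗-assoc c (a ∷ f) g = begin
  (c * a) · g ⊕ (0ℤ ∷ (c · f) ⊗ g)
    ≈⟨ ⊕-cong (·-assoc c a g) (∷-cong (sym (ℤP.*-zeroʳ c)) (·-⊗-assoc c f g)) ⟩
  c · (a · g) ⊕ c · (0ℤ ∷ f ⊗ g)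
    ≈⟨ ·-distribˡ-⊕ c (a · g) (0ℤ ∷ f ⊗ g) ⟨
  c · (a · g ⊕ (0ℤ ∷ f ⊗ g))
    ∎
  where open ≋-Reasoning

⊗-distribʳ-⊕ : ∀ h f g → (f ⊕ g) ⊗ h ≋ f ⊗ h ⊕ g ⊗ h
⊗-distribʳ-⊕ h []      g       = ≋-refl
⊗-distribʳ-⊕ h (a ∷ f) []      = ≋-sym (⊕-identityʳ _)
⊗-distribʳ-⊕ h (a ∷ f) (b ∷ g) = begin
  (a + b) · h ⊕ (0ℤ ∷ (f ⊕ g) ⊗ h)
    ≈⟨ ⊕-cong (·-distribʳ-+ a b h) (∷-cong refl (⊗-distribʳ-⊕ h f g)) ⟩
  (a · h ⊕ b · h) ⊕ ((0ℤ ∷ f ⊗ h) ⊕ (0ℤ ∷ g ⊗ h))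
    ≈⟨ interchange (a · h) (b · h) (0ℤ ∷ f ⊗ h) (0ℤ ∷ g ⊗ h) ⟩
  (a · h ⊕ (0ℤ ∷ f ⊗ h)) ⊕ (b · h ⊕ (0ℤ ∷ g ⊗ h))
    ∎
  where open ≋-Reasoning

0∷-⊗ : ∀ f g → (0ℤ ∷ f) ⊗ g ≋ 0ℤ ∷ f ⊗ g
0∷-⊗ f g = ⊕-cong (·-zeroˡ g) ≋-refl

⊗-assoc : ∀ f g h → (f ⊗ g) ⊗ h ≋ f ⊗ (g ⊗ h)
⊗-assoc []      g h = ≋-refl
⊗-assoc (a ∷ f) g h = begin
  (a · g ⊕ (0ℤ ∷ f ⊗ g)) ⊗ h         ≈⟨ ⊗-distribʳ-⊕ h (a · g) (0ℤ ∷ f ⊗ g) ⟩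
  (a · g) ⊗ h ⊕ (0ℤ ∷ f ⊗ g) ⊗ h     ≈⟨ ⊕-cong (·-⊗-assoc a g h) (0∷-⊗ (f ⊗ g) h) ⟩
  a · (g ⊗ h) ⊕ (0ℤ ∷ (f ⊗ g) ⊗ h)   ≈⟨ ⊕-cong ≋-refl (∷-cong refl (⊗-assoc f g h)) ⟩
  a · (g ⊗ h) ⊕ (0ℤ ∷ f ⊗ (g ⊗ h))   ∎
  where open ≋-Reasoning

⊗-zeroʳ : ∀ f → f ⊗ [] ≋ []
⊗-zeroʳ []      = ≋-refl
⊗-zeroʳ (a ∷ f) = mk≋ λ { zero → refl ; (suc n) → coeff-≡ (⊗-zeroʳ f) n }

⊗-∷ : ∀ f b g → f ⊗ (b ∷ g) ≋ b · f ⊕ (0ℤ ∷ f ⊗ g)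
⊗-∷ []      b g = []≋0∷[]
⊗-∷ (a ∷ f) b g = begin
  a · (b ∷ g) ⊕ (0ℤ ∷ f ⊗ (b ∷ g))
    ≈⟨ ⊕-cong (≋-refl {a · (b ∷ g)}) (∷-cong refl (⊗-∷ f b g)) ⟩
  (a * b + 0ℤ) ∷ (a · g ⊕ (b · f ⊕ (0ℤ ∷ f ⊗ g)))
    ≈⟨ ∷-cong (cong (_+ 0ℤ) (ℤP.*-comm a b)) (x∙yz≈y∙xz (a · g) (b · f) (0ℤ ∷ f ⊗ g)) ⟩
  (b * a + 0ℤ) ∷ (b · f ⊕ (a · g ⊕ (0ℤ ∷ f ⊗ g)))
    ∎
  where open ≋-Reasoning

⊗-comm : ∀ f g → f ⊗ g ≋ g ⊗ f
⊗-comm []      g = ≋-sym (⊗-zeroʳ g)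
⊗-comm (a ∷ f) g = begin
  a · g ⊕ (0ℤ ∷ f ⊗ g)  ≈⟨ ⊕-cong ≋-refl (∷-cong refl (⊗-comm f g)) ⟩
  a · g ⊕ (0ℤ ∷ g ⊗ f)  ≈⟨ ⊗-∷ g a f ⟨
  g ⊗ (a ∷ f)           ∎
  where open ≋-Reasoning

⊗-cong : ∀ {f f′ g g′} → f ≋ f′ → g ≋ g′ → f ⊗ g ≋ f′ ⊗ g′
⊗-cong {f} {f′} {g} {g′} f≋f′ g≋g′ = begin
  f ⊗ g    ≈⟨ ⊗-comm f g ⟩
  g ⊗ f    ≈⟨ ⊗-congʳ g f≋f′ ⟩
  g ⊗ f′   ≈⟨ ⊗-comm g f′ ⟩
  f′ ⊗ g   ≈⟨ ⊗-congʳ f′ g≋g′ ⟩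
  f′ ⊗ g′  ∎
  where open ≋-Reasoning

1ₚ : Poly
1ₚ = 1ℤ ∷ []

⊗-identityˡ : ∀ f → 1ₚ ⊗ f ≋ f
⊗-identityˡ f = begin
  1ℤ · f ⊕ (0ℤ ∷ [])  ≈⟨ ⊕-cong (·-identityˡ f) (≋-sym []≋0∷[]) ⟩
  f ⊕ []              ≈⟨ ⊕-identityʳ f ⟩
  f                   ∎
  where open ≋-Reasoning

⊗-isCommutativeMonoid : IsCommutativeMonoid _⊗_ 1ₚ
⊗-isCommutativeMonoid = isCommutativeMonoidˡ record
  { isSemigroup = record
    { isMagma = record { isEquivalence = ≋-isEquivalence ; ∙-cong = ⊗-cong }
    ; assoc   = ⊗-assoc
    }
  ; identityˡ = ⊗-identityˡ
  ; comm      = ⊗-comm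
  }

Poly-commutativeSemiring : CommutativeSemiring _ _
Poly-commutativeSemiring = record
  { isCommutativeSemiring = isCommutativeSemiringˡ record
    { +-isCommutativeMonoid = ⊕-isCommutativeMonoid
    ; *-isCommutativeMonoid = ⊗-isCommutativeMonoid
    ; distribʳ              = ⊗-distribʳ-⊕
    ; zeroˡ                 = λ _ → ≋-refl
    }
  }

Poly-almostCommutativeRing : AlmostCommutativeRing _ _
Poly-almostCommutativeRing = fromCommutativeSemiring Poly-commutativeSemiring (λ _ → nothing)

q : Poly
q = 0ℤ ∷ 1ℤ ∷ []

q⊗-shift : ∀ f → q ⊗ f ≋ 0ℤ ∷ f
q⊗-shift f = ⊕-cong (·-zeroˡ f) (∷-cong refl (⊗-identityˡ f))

record NonNeg (f : Poly) : Set where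
  constructor nonneg
  field coeff-nonneg : ∀ n → 0ℤ ≤ coeff f n
open NonNeg public

Nonzero : Poly → Set
Nonzero f = ¬ f ≋ []

nonneg-cong : ∀ {f g} → f ≋ g → NonNeg f → NonNeg g
nonneg-cong (mk≋ e) (nonneg f≥0) = nonneg λ n → ℤP.≤-trans (f≥0 n) (ℤP.≤-reflexive (e n))

nonneg-[] : NonNeg []
nonneg-[] = nonneg λ _ → ℤP.≤-refl

nonneg-∷ : ∀ {a f} → 0ℤ ≤ a → NonNeg f → NonNeg (a ∷ f)
nonneg-∷ a≥0 (nonneg f≥0) = nonneg λ { zero → a≥0 ; (suc n) → f≥0 n }

nonneg-1ₚ : NonNeg 1ₚ
nonneg-1ₚ = nonneg-∷ (+≤+ z≤n) nonneg-[]

nonneg-q : NonNeg q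
nonneg-q = nonneg-∷ ℤP.≤-refl nonneg-1ₚ

nonneg-⊕ : ∀ {f g} → NonNeg f → NonNeg g → NonNeg (f ⊕ g)
nonneg-⊕ {f} {g} (nonneg f≥0) (nonneg g≥0) = nonneg λ n →
  ℤP.≤-trans (ℤP.+-mono-≤ (f≥0 n) (g≥0 n)) (ℤP.≤-reflexive (sym (coeff-⊕ f g n)))

nonneg-· : ∀ {c f} → 0ℤ ≤ c → NonNeg f → NonNeg (c · f)
nonneg-· {c} {f} c≥0 (nonneg f≥0) = nonneg λ n →
  ℤP.≤-trans (*-nonneg c≥0 (f≥0 n)) (ℤP.≤-reflexive (sym (coeff-· c f n)))
  where
  *-nonneg : ∀ {a b} → 0ℤ ≤ a → 0ℤ ≤ b → 0ℤ ≤ a * b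
  *-nonneg {b = b} a≥0 b≥0 = ℤP.*-monoʳ-≤-nonNeg b {{nonNegative b≥0}} a≥0

nonneg-⊗ : ∀ {f g} → NonNeg f → NonNeg g → NonNeg (f ⊗ g)
nonneg-⊗ {[]}    _              _   = nonneg-[]
nonneg-⊗ {a ∷ f} (nonneg a∷f≥0) g≥0 = nonneg-⊕ (nonneg-· (a∷f≥0 zero) g≥0)
  (nonneg-∷ ℤP.≤-refl (nonneg-⊗ {f} (nonneg (a∷f≥0 ∘ suc)) g≥0))

nonneg-q⊗ : ∀ {f} → NonNeg f → NonNeg (q ⊗ f)
nonneg-q⊗ = nonneg-⊗ nonneg-q

nonzero-⊕ʳ : ∀ {f g} → NonNeg f → NonNeg g → Nonzero g → Nonzero (f ⊕ g)
nonzero-⊕ʳ {f} {g} (nonneg f≥0) (nonneg g≥0) g≢0 (mk≋ f⊕g≈0) =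
  g≢0 (mk≋ λ n → ℤP.≤-antisym (g≤0 n) (g≥0 n))
  where
  open ℤP.≤-Reasoning
  g≤0 : ∀ n → coeff g n ≤ 0ℤ
  g≤0 n = begin
    coeff g n              ≡⟨ ℤP.+-identityˡ (coeff g n) ⟨
    0ℤ + coeff g n         ≤⟨ ℤP.+-monoˡ-≤ (coeff g n) (f≥0 n) ⟩
    coeff f n + coeff g n  ≡⟨ coeff-⊕ f g n ⟨
    coeff (f ⊕ g) n        ≡⟨ f⊕g≈0 n ⟩
    0ℤ                     ∎

nonzero-1ₚ : Nonzero 1ₚ
nonzero-1ₚ 1ₚ≋0 with coeff-≡ 1ₚ≋0 zero
... | ()

nonzero-q⊗ : ∀ {f} → Nonzero f → Nonzero (q ⊗ f)
nonzero-q⊗ f≢0 qf≋0 = f≢0 (mk≋ (coeff-≡ (≋-trans (≋-sym (q⊗-shift _)) qf≋0) ∘ suc))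

≺-from-gap : ∀ f {g e} → g ≋ f ⊕ e → NonNeg e → Nonzero e → f ≺ g
≺-from-gap f {g} {e} (mk≋ g≈f⊕e) (nonneg e≥0) e≢0 = f≉g , f≤g
  where
  g-split : ∀ n → coeff g n ≡ coeff f n + coeff e n
  g-split n = trans (g≈f⊕e n) (coeff-⊕ f e n)
  f≉g : ¬ f ≈ₚ g
  f≉g f≈g = e≢0 (mk≋ λ n →
    identityʳ-unique (coeff f n) (coeff e n) (trans (sym (g-split n)) (sym (f≈g n))))
  f≤g : ∀ n → coeff f n ≤ coeff g n
  f≤g n = begin
    coeff f n              ≡⟨ ℤP.+-identityʳ (coeff f n) ⟨
    coeff f n + 0ℤ         ≤⟨ ℤP.+-monoʳ-≤ (coeff f n) (e≥0 n) ⟩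
    coeff f n + coeff e n  ≡⟨ g-split n ⟨
    coeff g n              ∎
    where open ℤP.≤-Reasoning

infix 4 _≋ₘ_ _≋ₘ?_

record _≋ₘ_ (M N : Mat) : Set where
  constructor mk≋ₘ
  field
    ≋₁₁ : m11 M ≋ m11 N
    ≋₁₂ : m12 M ≋ m12 N
    ≋₂₁ : m21 M ≋ m21 N
    ≋₂₂ : m22 M ≋ m22 N
open _≋ₘ_ public

≋ₘ-refl : ∀ {M} → M ≋ₘ M
≋ₘ-refl = mk≋ₘ ≋-refl ≋-refl ≋-refl ≋-refl

≋ₘ-sym : ∀ {M N} → M ≋ₘ N → N ≋ₘ M
≋ₘ-sym (mk≋ₘ e₁₁ e₁₂ e₂₁ e₂₂) = mk≋ₘ (≋-sym e₁₁) (≋-sym e₁₂) (≋-sym e₂₁) (≋-sym e₂₂)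

≋ₘ-trans : ∀ {M N P} → M ≋ₘ N → N ≋ₘ P → M ≋ₘ P
≋ₘ-trans (mk≋ₘ e₁₁ e₁₂ e₂₁ e₂₂) (mk≋ₘ e₁₁′ e₁₂′ e₂₁′ e₂₂′) =
  mk≋ₘ (≋-trans e₁₁ e₁₁′) (≋-trans e₁₂ e₁₂′) (≋-trans e₂₁ e₂₁′) (≋-trans e₂₂ e₂₂′)

_≋ₘ?_ : Decidable _≋ₘ_
M ≋ₘ? N = map′ (λ (e₁₁ , e₁₂ , e₂₁ , e₂₂) → mk≋ₘ e₁₁ e₁₂ e₂₁ e₂₂)
               (λ (mk≋ₘ e₁₁ e₁₂ e₂₁ e₂₂) → e₁₁ , e₁₂ , e₂₁ , e₂₂)
               (m11 M ≋? m11 N ×-dec m12 M ≋? m12 N ×-dec m21 M ≋? m21 N ×-dec m22 M ≋? m22 N)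

⊠-cong : ∀ {M M′ N N′} → M ≋ₘ M′ → N ≋ₘ N′ → M ⊠ N ≋ₘ M′ ⊠ N′
⊠-cong (mk≋ₘ a b c d) (mk≋ₘ e f g h) = mk≋ₘ
  (⊕-cong (⊗-cong a e) (⊗-cong b g)) (⊕-cong (⊗-cong a f) (⊗-cong b h))
  (⊕-cong (⊗-cong c e) (⊗-cong d g)) (⊕-cong (⊗-cong c f) (⊗-cong d h))

⊠-assoc-entry : ∀ a b e f g h i k →
  (a ⊗ e ⊕ b ⊗ g) ⊗ i ⊕ (a ⊗ f ⊕ b ⊗ h) ⊗ k ≋ a ⊗ (e ⊗ i ⊕ f ⊗ k) ⊕ b ⊗ (g ⊗ i ⊕ h ⊗ k)
⊠-assoc-entry = solve-∀ Poly-almostCommutativeRing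

⊠-assoc : ∀ M N P → (M ⊠ N) ⊠ P ≋ₘ M ⊠ (N ⊠ P)
⊠-assoc (mat a b c d) (mat e f g h) (mat i j k l) = mk≋ₘ
  (⊠-assoc-entry a b e f g h i k) (⊠-assoc-entry a b e f g h j l)
  (⊠-assoc-entry c d e f g h i k) (⊠-assoc-entry c d e f g h j l)

-- μLetter with its entries written in terms of q, so that q can be a solver variable.
μAt : Poly → Letter → Mat
μAt x 𝟎 = mat (x ⊕ x ⊗ x) 1ₚ x 1ₚ
μAt x 𝟏 = mat (x ⊕ x ⊗ x ⊕ x ⊗ x ⊕ x ⊗ x ⊗ x ⊕ x ⊗ x ⊗ x ⊗ x) (1ₚ ⊕ x) (x ⊕ x ⊗ x) 1ₚ

μLetter≋μAt : ∀ y → μLetter y ≋ₘ μAt q y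
μLetter≋μAt 𝟎 = from-yes (μLetter 𝟎 ≋ₘ? μAt q 𝟎)
μLetter≋μAt 𝟏 = from-yes (μLetter 𝟏 ≋ₘ? μAt q 𝟏)

μ-∷ʳ : ∀ w y → μ (w ∷ʳ y) ≋ₘ μ w ⊠ μAt q y
μ-∷ʳ []      𝟎 = from-yes (μ (𝟎 ∷ []) ≋ₘ? I₂ ⊠ μAt q 𝟎)
μ-∷ʳ []      𝟏 = from-yes (μ (𝟏 ∷ []) ≋ₘ? I₂ ⊠ μAt q 𝟏)
μ-∷ʳ (x ∷ w) y = ≋ₘ-trans (⊠-cong (≋ₘ-refl {μLetter x}) (μ-∷ʳ w y))
                          (≋ₘ-sym (⊠-assoc (μLetter x) (μ w) (μAt q y)))

record NonNegₘ (M : Mat) : Set where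
  constructor nonnegₘ
  field
    nonneg₁₁ : NonNeg (m11 M)
    nonneg₁₂ : NonNeg (m12 M)
    nonneg₂₁ : NonNeg (m21 M)
    nonneg₂₂ : NonNeg (m22 M)
open NonNegₘ public

nonnegₘ-cong : ∀ {M N} → M ≋ₘ N → NonNegₘ M → NonNegₘ N
nonnegₘ-cong (mk≋ₘ e₁₁ e₁₂ e₂₁ e₂₂) (nonnegₘ a b c d) =
  nonnegₘ (nonneg-cong e₁₁ a) (nonneg-cong e₁₂ b) (nonneg-cong e₂₁ c) (nonneg-cong e₂₂ d)

nonneg-⊠ : ∀ {M N} → NonNegₘ M → NonNegₘ N → NonNegₘ (M ⊠ N)
nonneg-⊠ (nonnegₘ a b c d) (nonnegₘ e f g h) = nonnegₘ
  (nonneg-⊕ (nonneg-⊗ a e) (nonneg-⊗ b g)) (nonneg-⊕ (nonneg-⊗ a f) (nonneg-⊗ b h))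
  (nonneg-⊕ (nonneg-⊗ c e) (nonneg-⊗ d g)) (nonneg-⊕ (nonneg-⊗ c f) (nonneg-⊗ d h))

nonneg-μAt : ∀ {x} → NonNeg x → ∀ y → NonNegₘ (μAt x y)
nonneg-μAt x≥0 𝟎 = nonnegₘ (nonneg-⊕ x≥0 (nonneg-⊗ x≥0 x≥0)) nonneg-1ₚ x≥0 nonneg-1ₚ
nonneg-μAt x≥0 𝟏 = nonnegₘ
  (nonneg-⊕ (nonneg-⊕ (nonneg-⊕ (nonneg-⊕ x≥0 x²≥0) x²≥0) x³≥0) (nonneg-⊗ x³≥0 x≥0))
  (nonneg-⊕ nonneg-1ₚ x≥0) (nonneg-⊕ x≥0 x²≥0) nonneg-1ₚ
  where
  x²≥0 = nonneg-⊗ x≥0 x≥0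
  x³≥0 = nonneg-⊗ x²≥0 x≥0

record Admissible (M : Mat) : Set where
  field
    entries-nonneg  : NonNegₘ M
    surplus         : Poly
    m11-split       : m11 M ≋ q ⊗ m12 M ⊕ surplus
    surplus-nonneg  : NonNeg surplus
    surplus-nonzero : Nonzero surplus

  m11-nonzero : Nonzero (m11 M)
  m11-nonzero m11≋0 = nonzero-⊕ʳ (nonneg-q⊗ (nonneg₁₂ entries-nonneg))
    surplus-nonneg surplus-nonzero (≋-trans (≋-sym m11-split) m11≋0)

  split-form : M ≋ₘ mat (q ⊗ m12 M ⊕ surplus) (m12 M) (m21 M) (m22 M)
  split-form = mk≋ₘ m11-split ≋-refl ≋-refl ≋-refl
open Admissible

admissible-cong : ∀ {M N} → M ≋ₘ N → Admissible M → Admissible N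
admissible-cong M≋N adm = record
  { entries-nonneg  = nonnegₘ-cong M≋N (entries-nonneg adm)
  ; surplus         = surplus adm
  ; m11-split       = ≋-trans (≋-sym (≋₁₁ M≋N))
                        (≋-trans (m11-split adm) (⊕-cong (⊗-congʳ q (≋₁₂ M≋N)) ≋-refl))
  ; surplus-nonneg  = surplus-nonneg adm
  ; surplus-nonzero = surplus-nonzero adm
  }

admissible-I₂ : Admissible I₂
admissible-I₂ = record
  { entries-nonneg  = nonnegₘ nonneg-1ₚ nonneg-[] nonneg-[] nonneg-1ₚ
  ; surplus         = 1ₚ
  ; m11-split       = from-yes (1ₚ ≋? q ⊗ [] ⊕ 1ₚ)
  ; surplus-nonneg  = nonneg-1ₚ
  ; surplus-nonzero = nonzero-1ₚ
  }

surplus-⊠μAt : Letter → Poly → Poly → Poly → Poly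
surplus-⊠μAt 𝟎 x a b = x ⊗ (x ⊗ a)
surplus-⊠μAt 𝟏 x a b = x ⊗ (x ⊗ (b ⊕ x ⊗ (a ⊕ x ⊗ a) ⊕ a))

-- solve-∀ only puts its goal in weak head normal form, so each identity about
-- matrix entries is proved in an expanded form that agrees definitionally.
m11-⊠μAt : ∀ y x a b c d →
  m11 (mat a b c d ⊠ μAt x y) ≋ x ⊗ m12 (mat a b c d ⊠ μAt x y) ⊕ surplus-⊠μAt y x a b
m11-⊠μAt 𝟎 x a b _ _ = expanded x a b
  where
  expanded : ∀ x a b → a ⊗ (x ⊕ x ⊗ x) ⊕ b ⊗ x ≋ x ⊗ (a ⊗ 1ₚ ⊕ b ⊗ 1ₚ) ⊕ x ⊗ (x ⊗ a)
  expanded = solve-∀ Poly-almostCommutativeRing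
m11-⊠μAt 𝟏 x a b _ _ = expanded x a b
  where
  expanded : ∀ x a b →
    a ⊗ (x ⊕ x ⊗ x ⊕ x ⊗ x ⊕ x ⊗ x ⊗ x ⊕ x ⊗ x ⊗ x ⊗ x) ⊕ b ⊗ (x ⊕ x ⊗ x)
      ≋ x ⊗ (a ⊗ (1ₚ ⊕ x) ⊕ b ⊗ 1ₚ) ⊕ x ⊗ (x ⊗ (b ⊕ x ⊗ (a ⊕ x ⊗ a) ⊕ a))
  expanded = solve-∀ Poly-almostCommutativeRing

surplus-⊠μAt-positive : ∀ y {a b} → NonNeg a → NonNeg b → Nonzero a →
  NonNeg (surplus-⊠μAt y q a b) × Nonzero (surplus-⊠μAt y q a b)
surplus-⊠μAt-positive 𝟎 a≥0 b≥0 a≢0 = nonneg-q⊗ (nonneg-q⊗ a≥0) , nonzero-q⊗ (nonzero-q⊗ a≢0)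
surplus-⊠μAt-positive 𝟏 a≥0 b≥0 a≢0 =
  nonneg-q⊗ (nonneg-q⊗ (nonneg-⊕ others≥0 a≥0)) ,
  nonzero-q⊗ (nonzero-q⊗ (nonzero-⊕ʳ others≥0 a≥0 a≢0))
  where others≥0 = nonneg-⊕ b≥0 (nonneg-q⊗ (nonneg-⊕ a≥0 (nonneg-q⊗ a≥0)))

admissible-⊠μAt : ∀ y {M} → Admissible M → Admissible (M ⊠ μAt q y)
admissible-⊠μAt y {M} adm = record
  { entries-nonneg  = nonneg-⊠ (entries-nonneg adm) (nonneg-μAt nonneg-q y)
  ; surplus         = surplus-⊠μAt y q (m11 M) (m12 M)
  ; m11-split       = m11-⊠μAt y q (m11 M) (m12 M) (m21 M) (m22 M)
  ; surplus-nonneg  = proj₁ positive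
  ; surplus-nonzero = proj₂ positive
  }
  where
  positive = surplus-⊠μAt-positive y (nonneg₁₁ (entries-nonneg adm))
               (nonneg₁₂ (entries-nonneg adm)) (m11-nonzero adm)

admissible-μ : ∀ w → Admissible (μ w)
admissible-μ w = go (reverseView w)
  where
  go : ∀ {w} → Reverse w → Admissible (μ w)
  go []            = admissible-I₂
  go (w ∶ w′ ∶ʳ y) = admissible-cong (≋ₘ-sym (μ-∷ʳ w y)) (admissible-⊠μAt y (go w′))

m12-⊠μAt𝟏 : ∀ x a b c d → m12 (mat a b c d ⊠ μAt x 𝟏) ≋ m12 (mat a b c d ⊠ μAt x 𝟎) ⊕ x ⊗ a
m12-⊠μAt𝟏 x a b _ _ = expanded x a b
  where
  expanded : ∀ x a b → a ⊗ (1ₚ ⊕ x) ⊕ b ⊗ 1ₚ ≋ a ⊗ 1ₚ ⊕ b ⊗ 1ₚ ⊕ x ⊗ a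
  expanded = solve-∀ Poly-almostCommutativeRing

m12-μ-++𝟎≺++𝟏 : ∀ w → m12 (μ (w ++ 𝟎 ∷ [])) ≺ m12 (μ (w ++ 𝟏 ∷ []))
m12-μ-++𝟎≺++𝟏 w = ≺-from-gap (m12 (μ (w ++ 𝟎 ∷ []))) gap
  (nonneg-q⊗ (nonneg₁₁ (entries-nonneg adm))) (nonzero-q⊗ (m11-nonzero adm))
  where
  M   = μ w
  adm = admissible-μ w
  gap : m12 (μ (w ++ 𝟏 ∷ [])) ≋ m12 (μ (w ++ 𝟎 ∷ [])) ⊕ q ⊗ m11 M
  gap = begin
    m12 (μ (w ++ 𝟏 ∷ []))              ≈⟨ ≋₁₂ (μ-∷ʳ w 𝟏) ⟩
    m12 (M ⊠ μAt q 𝟏)                  ≈⟨ m12-⊠μAt𝟏 q (m11 M) (m12 M) (m21 M) (m22 M) ⟩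
    m12 (M ⊠ μAt q 𝟎) ⊕ q ⊗ m11 M      ≈⟨ ⊕-cong (≋₁₂ (μ-∷ʳ w 𝟎)) ≋-refl ⟨
    m12 (μ (w ++ 𝟎 ∷ [])) ⊕ q ⊗ m11 M  ∎
    where open ≋-Reasoning

gap-μAt : Letter → Poly → Poly → Poly → Poly → Poly → Poly
gap-μAt 𝟎 x b c d s = x ⊗ (x ⊗ (c ⊕ x ⊗ s))
gap-μAt 𝟏 x b c d s =
  x ⊗ (x ⊗ (d ⊕ c ⊕ x ⊗ (c ⊕ b ⊕ x ⊗ (c ⊕ a ⊕ x ⊗ (a ⊕ x ⊗ a)) ⊕ a)))
  where a = x ⊗ b ⊕ s

gap-μAt-positive : ∀ y {b c d s} → NonNeg b → NonNeg c → NonNeg d → NonNeg s → Nonzero s →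
  NonNeg (gap-μAt y q b c d s) × Nonzero (gap-μAt y q b c d s)
gap-μAt-positive 𝟎 b≥0 c≥0 d≥0 s≥0 s≢0 =
  nonneg-q⊗ (nonneg-q⊗ (nonneg-⊕ c≥0 (nonneg-q⊗ s≥0))) ,
  nonzero-q⊗ (nonzero-q⊗ (nonzero-⊕ʳ c≥0 (nonneg-q⊗ s≥0) (nonzero-q⊗ s≢0)))
gap-μAt-positive 𝟏 b≥0 c≥0 d≥0 s≥0 s≢0 =
  nonneg-q⊗ (nonneg-q⊗ (nonneg-⊕ (nonneg-⊕ d≥0 c≥0) (nonneg-q⊗ inner≥0))) ,
  nonzero-q⊗ (nonzero-q⊗ (nonzero-⊕ʳ (nonneg-⊕ d≥0 c≥0) (nonneg-q⊗ inner≥0)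
    (nonzero-q⊗ (nonzero-⊕ʳ others≥0 a≥0 a≢0))))
  where
  a≥0 = nonneg-⊕ (nonneg-q⊗ b≥0) s≥0
  a≢0 = nonzero-⊕ʳ (nonneg-q⊗ b≥0) s≥0 s≢0
  others≥0 = nonneg-⊕ (nonneg-⊕ c≥0 b≥0)
    (nonneg-q⊗ (nonneg-⊕ (nonneg-⊕ c≥0 a≥0) (nonneg-q⊗ (nonneg-⊕ a≥0 (nonneg-q⊗ a≥0)))))
  inner≥0 = nonneg-⊕ others≥0 a≥0

m12-μAt𝟎⊠⊠μAt𝟎 : ∀ y x b c d s → let N = mat (x ⊗ b ⊕ s) b c d in
  m12 (μAt x 𝟎 ⊠ ((N ⊠ μAt x y) ⊠ μAt x 𝟎)) ≋ m12 (μAt x 𝟏 ⊠ (N ⊠ μAt x y)) ⊕ gap-μAt y x b c d s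
m12-μAt𝟎⊠⊠μAt𝟎 𝟎 = expanded
  where
  expanded : ∀ x b c d s →
    let a  = x ⊗ b ⊕ s
        m₀ = x ⊕ x ⊗ x
        m₁ = x ⊕ x ⊗ x ⊕ x ⊗ x ⊕ x ⊗ x ⊗ x ⊕ x ⊗ x ⊗ x ⊗ x
        r  = a ⊗ 1ₚ ⊕ b ⊗ 1ₚ
        t  = c ⊗ 1ₚ ⊕ d ⊗ 1ₚ
    in m₀ ⊗ ((a ⊗ m₀ ⊕ b ⊗ x) ⊗ 1ₚ ⊕ r ⊗ 1ₚ) ⊕ 1ₚ ⊗ ((c ⊗ m₀ ⊕ d ⊗ x) ⊗ 1ₚ ⊕ t ⊗ 1ₚ)
       ≋ m₁ ⊗ r ⊕ (1ₚ ⊕ x) ⊗ t ⊕ x ⊗ (x ⊗ (c ⊕ x ⊗ s))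
  expanded = solve-∀ Poly-almostCommutativeRing
m12-μAt𝟎⊠⊠μAt𝟎 𝟏 = expanded
  where
  expanded : ∀ x b c d s →
    let a  = x ⊗ b ⊕ s
        m₀ = x ⊕ x ⊗ x
        m₁ = x ⊕ x ⊗ x ⊕ x ⊗ x ⊕ x ⊗ x ⊗ x ⊕ x ⊗ x ⊗ x ⊗ x
        r  = a ⊗ (1ₚ ⊕ x) ⊕ b ⊗ 1ₚ
        t  = c ⊗ (1ₚ ⊕ x) ⊕ d ⊗ 1ₚ
    in m₀ ⊗ ((a ⊗ m₁ ⊕ b ⊗ m₀) ⊗ 1ₚ ⊕ r ⊗ 1ₚ) ⊕ 1ₚ ⊗ ((c ⊗ m₁ ⊕ d ⊗ m₀) ⊗ 1ₚ ⊕ t ⊗ 1ₚ)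
       ≋ m₁ ⊗ r ⊕ (1ₚ ⊕ x) ⊗ t
         ⊕ x ⊗ (x ⊗ (d ⊕ c ⊕ x ⊗ (c ⊕ b ⊕ x ⊗ (c ⊕ a ⊕ x ⊗ (a ⊕ x ⊗ a)) ⊕ a)))
  expanded = solve-∀ Poly-almostCommutativeRing

m12-μ-𝟏∷≺𝟎∷++𝟎 : ∀ w → m12 (μ (𝟏 ∷ w)) ≺ m12 (μ (𝟎 ∷ w ++ 𝟎 ∷ []))
m12-μ-𝟏∷≺𝟎∷++𝟎 w with initLast w
... | [] = ≺-from-gap (m12 (μ (𝟏 ∷ [])))
             (from-yes (m12 (μ (𝟎 ∷ 𝟎 ∷ [])) ≋? m12 (μ (𝟏 ∷ [])) ⊕ q ⊗ (q ⊗ 1ₚ)))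
             (nonneg-q⊗ (nonneg-q⊗ nonneg-1ₚ)) (nonzero-q⊗ (nonzero-q⊗ nonzero-1ₚ))
... | w′ ∷ʳ′ y = ≺-from-gap (m12 (μ (𝟏 ∷ w′ ∷ʳ y))) gap (proj₁ positive) (proj₂ positive)
  where
  adm = admissible-μ w′
  b   = m12 (μ w′)
  c   = m21 (μ w′)
  d   = m22 (μ w′)
  s   = surplus adm
  a   = q ⊗ b ⊕ s
  N   = mat a b c d
  μw≋ : μ (w′ ∷ʳ y) ≋ₘ N ⊠ μAt q y
  μw≋ = ≋ₘ-trans (μ-∷ʳ w′ y) (⊠-cong (split-form adm) ≋ₘ-refl)
  gap : m12 (μ (𝟎 ∷ (w′ ∷ʳ y) ∷ʳ 𝟎)) ≋ m12 (μ (𝟏 ∷ w′ ∷ʳ y)) ⊕ gap-μAt y q b c d s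
  gap = begin
    m12 (μ (𝟎 ∷ (w′ ∷ʳ y) ∷ʳ 𝟎))
      ≈⟨ ≋₁₂ (⊠-cong (μLetter≋μAt 𝟎) (≋ₘ-trans (μ-∷ʳ (w′ ∷ʳ y) 𝟎) (⊠-cong μw≋ ≋ₘ-refl))) ⟩
    m12 (μAt q 𝟎 ⊠ ((N ⊠ μAt q y) ⊠ μAt q 𝟎))
      ≈⟨ m12-μAt𝟎⊠⊠μAt𝟎 y q b c d s ⟩
    m12 (μAt q 𝟏 ⊠ (N ⊠ μAt q y)) ⊕ gap-μAt y q b c d s
      ≈⟨ ⊕-cong (≋₁₂ (⊠-cong (μLetter≋μAt 𝟏) μw≋)) ≋-refl ⟨
    m12 (μ (𝟏 ∷ w′ ∷ʳ y)) ⊕ gap-μAt y q b c d s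
      ∎
    where open ≋-Reasoning
  positive = gap-μAt-positive y (nonneg₁₂ (entries-nonneg adm)) (nonneg₂₁ (entries-nonneg adm))
               (nonneg₂₂ (entries-nonneg adm)) (surplus-nonneg adm) (surplus-nonzero adm)

proposition3p1 : (w : Word) →
    (m12 (μ (w ++ 𝟎 ∷ [])) ≺ m12 (μ (w ++ 𝟏 ∷ [])))
    × (m12 (μ (𝟏 ∷ w)) ≺ m12 (μ (𝟎 ∷ w ++ 𝟎 ∷ [])))
    × (m12 (μ (𝟎 ∷ w ++ 𝟎 ∷ [])) ≺ m12 (μ (𝟎 ∷ w ++ 𝟏 ∷ [])))
proposition3p1 w = m12-μ-++𝟎≺++𝟏 w , m12-μ-𝟏∷≺𝟎∷++𝟎 w , m12-μ-++𝟎≺++𝟏 (𝟎 ∷ w)
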